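{- Let $G$ be a group with rotary pair $(a,z)$, and let $\Gamma=\mathrm{Cos}(G,\langle a\rangle,\langle z\rangle)$, with vertex set $V=[G:\langle a\rangle]$, valency $k$ and edge-multiplicity $\lambda$ (so $|a|=k\lambda$). Then: (a) the kernel of the action of $G$ on $V$ is $G_{(V)}=\langle a\rangle\cap\langle a^z\rangle$; (b) $\langle a\rangle\cap\langle az\rangle$ and $\langle a\rangle\cap\langle zz^a\rangle$ are normal subgroups of $G$; (c) if either $\langle a\rangle\cap\langle az\rangle$ has index at most $2$ in $\langle az\rangle$, or $\langle a\rangle\cap\langle z,z^a\rangle$ has index at most $2$ in $\langle z,z^a\rangle$, then $G=\langle a\rangle\rtimes\langle z\rangle$ and $\Gamma=\mathbf K_2^{(\lambda)}$ with $\lambda=|a|$.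
   Context: A rotary pair for $G$ is $(a,z)$ with $G=\langle a,z\rangle$, $|a|$ finite, $|z|=2$, $z\notin\langle a\rangle$. $\mathrm{Cos}(G,\langle a\rangle,\langle z\rangle)$ is the graph with vertex set $[G:\langle a\rangle]$, edge set $[G:\langle z\rangle]$ (right cosets), a vertex and an edge being incident iff the cosets intersect non-trivially; $G$ acts by right multiplication. Valency: number of neighbours of a vertex; edge-multiplicity: number of edges joining two adjacent vertices. $\mathbf K_2^{(\lambda)}$: two vertices joined by $\lambda$ edges. $a^z=z^{ -1}az$. $G_{(V)}$: subgroup fixing every vertex. -}

module Defs where

open import Level using (Level; _⊔_)
open import Algebra.Bundles using (Group)
open import Data.Nat using (ℕ; zero; suc; _<_; _≤_)
open import Data.Fin using (Fin)
open import Data.Product using (Σ; _×_; _,_; ∃)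
open import Data.Sum using (_⊎_)
open import Data.Unit.Polymorphic using (⊤)
open import Relation.Nullary using (¬_)
open import Relation.Binary.PropositionalEquality using (_≡_)

module GroupDefs {c ℓ : Level} (G : Group c ℓ) where
  open Group G

  pow : Carrier → ℕ → Carrier
  pow x zero    = ε
  pow x (suc n) = x ∙ pow x n

  IsOrder : Carrier → ℕ → Set ℓ
  IsOrder x n = (1 ≤ n) × (pow x n ≈ ε) × (∀ m → 1 ≤ m → m < n → ¬ (pow x m ≈ ε))

  data Gen {ℓ'} (S : Carrier → Set ℓ') : Carrier → Set (c ⊔ ℓ ⊔ ℓ') where
    gen  : ∀ {x} → S x → Gen S x
    unit : Gen S ε
    mul  : ∀ {x y} → Gen S x → Gen S y → Gen S (x ∙ y)
    inv  : ∀ {x} → Gen S x → Gen S (x ⁻¹)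
    resp : ∀ {x y} → x ≈ y → Gen S x → Gen S y

  ⟨_⟩ : Carrier → Carrier → Set (c ⊔ ℓ)
  ⟨ x ⟩ = Gen (λ w → w ≈ x)

  ⟨_&_⟩ : Carrier → Carrier → Carrier → Set (c ⊔ ℓ)
  ⟨ x & y ⟩ = Gen (λ w → (w ≈ x) ⊎ (w ≈ y))

  _∩_ : ∀ {p q} → (Carrier → Set p) → (Carrier → Set q) → Carrier → Set (p ⊔ q)
  (P ∩ Q) x = P x × Q x

  _^_ : Carrier → Carrier → Carrier
  x ^ y = y ⁻¹ ∙ x ∙ y

  IsNormal : ∀ {p} → (Carrier → Set p) → Set (c ⊔ p)
  IsNormal H = ∀ g x → H x → H (g ⁻¹ ∙ x ∙ g)

  -- L has at most two right cosets in K  (for L ⊆ K subgroups):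
  -- there is t ∈ K with K ⊆ L ∪ L t
  IndexAtMost2 : ∀ {p q} → (Carrier → Set p) → (Carrier → Set q) → Set (c ⊔ p ⊔ q)
  IndexAtMost2 L K = Σ Carrier λ t → K t × (∀ k → K k → L k ⊎ L (k ∙ t ⁻¹))

  record RotaryPair (a z : Carrier) (n : ℕ) : Set (c ⊔ ℓ) where
    field
      generates : ∀ g → ⟨ a & z ⟩ g
      order-a   : IsOrder a n
      order-z   : IsOrder z 2
      z∉⟨a⟩     : ¬ ⟨ a ⟩ z

  -- number of classes: the elements of P, up to the equivalence R, are
  -- exactly n classes
  CardIs : ∀ {r p} → ℕ → (Carrier → Carrier → Set r) → (Carrier → Set p) → Set (c ⊔ r ⊔ p)
  CardIs n R P =
    Σ (Fin n → Carrier) λ f →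
      (∀ i → P (f i)) × (∀ i j → R (f i) (f j) → i ≡ j) × (∀ x → P x → ∃ λ i → R x (f i))

  -- The coset graph Cos(G, ⟨a⟩, ⟨z⟩).  Vertices: right cosets ⟨a⟩ g, represented by g;
  -- edges: right cosets ⟨z⟩ h, represented by h.
  module CosetGraph (a z : Carrier) where
    VertexEq : Carrier → Carrier → Set (c ⊔ ℓ)
    VertexEq g g' = ⟨ a ⟩ (g ∙ g' ⁻¹)

    EdgeEq : Carrier → Carrier → Set (c ⊔ ℓ)
    EdgeEq h h' = ⟨ z ⟩ (h ∙ h' ⁻¹)

    Incident : Carrier → Carrier → Set (c ⊔ ℓ)
    Incident g h = Σ Carrier λ x → ⟨ a ⟩ (x ∙ g ⁻¹) × ⟨ z ⟩ (x ∙ h ⁻¹)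

    InKernel : Carrier → Set (c ⊔ ℓ)
    InKernel g = ∀ x → VertexEq (x ∙ g) x

    -- Γ ≅ K₂^(λ): exactly two vertices, exactly λ edges, and any two distinct
    -- vertices are joined by exactly λ edges
    IsK2 : ℕ → Set (c ⊔ ℓ)
    IsK2 λ' = CardIs 2 VertexEq (λ _ → ⊤ {c ⊔ ℓ})
            × CardIs λ' EdgeEq (λ _ → ⊤ {c ⊔ ℓ})
            × (∀ u v → ¬ VertexEq u v → CardIs λ' EdgeEq (λ h → Incident u h × Incident v h))

{-# OPTIONS --safe #-}
-- Conjugation by a fixes ⟨a⟩ pointwise and z is an involution, so a subset of ⟨a⟩
-- closed under conjugation by z is normal in G = ⟨a, z⟩.  This gives (b), and the
-- normality of ⟨a⟩ ∩ ⟨a^z⟩, which is then the core of ⟨a⟩, i.e. the kernel (a).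
-- In a subgroup of index at most 2, two elements outside it lie in the same coset;
-- applied to az, (az)² (respectively z, z^a), this forces a^z ∈ ⟨a⟩ as z ∉ ⟨a⟩.
-- Then ⟨a⟩ is normal and G = ⟨a⟩⟨z⟩ with ⟨a⟩ ∩ ⟨z⟩ = 1: the only vertices are ⟨a⟩ and ⟨a⟩z,
-- every vertex meets every edge, and the edges are the |a| cosets ⟨z⟩aⁱ.
module Submission where

open import Defs
open import Level using (Level; _⊔_)
open import Algebra.Bundles using (Group)
open import Data.Nat using (ℕ; zero; suc; _+_; _*_; _∸_; _<_; _%_; _/_; NonZero; >-nonZero)
open import Data.Nat.Properties
  using (<-cmp; *-comm; m∸n≤m; m<n⇒0<n∸m; m+[n∸m]≡n; <⇒≤; ≤-<-trans)
open import Data.Nat.DivMod using (m≡m%n+[m/n]*n; m%n<n)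
open import Data.Fin as Fin using (Fin; toℕ; fromℕ<)
open import Data.Fin.Properties using (toℕ-injective; toℕ-fromℕ<; toℕ<n)
open import Data.Product using (_×_; Σ; _,_; proj₁; proj₂; ∃)
open import Data.Sum as Sum using (_⊎_; inj₁; inj₂; [_,_]; [_,_]′)
open import Data.Empty using (⊥-elim)
open import Data.Unit.Polymorphic using (⊤; tt)
open import Relation.Nullary using (¬_)
open import Relation.Binary using (tri<; tri≈; tri>)
import Relation.Binary.PropositionalEquality as ≡
open ≡ using (_≡_)
open import Tactic.MonoidSolver using (solve)

module GroupProperties {c ℓ : Level} (G : Group c ℓ) where
  open Group G
  open GroupDefs G
  open import Algebra.Properties.Group G
  open import Algebra.Properties.Monoid monoid using (cancelᶜ; insertʳ; ε-comm)
  open import Relation.Binary.Reasoning.Setoid setoid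

  ^-congˡ : ∀ {x y g} → x ≈ y → x ^ g ≈ y ^ g
  ^-congˡ x≈y = ∙-congʳ (∙-congˡ x≈y)

  ^-congʳ : ∀ {x g h} → g ≈ h → x ^ g ≈ x ^ h
  ^-congʳ g≈h = ∙-cong (∙-congʳ (⁻¹-cong g≈h)) g≈h

  ^-identityʳ : ∀ x → x ^ ε ≈ x
  ^-identityʳ x = trans (identityʳ _) (trans (∙-congʳ ε⁻¹≈ε) (identityˡ x))

  ε-^ : ∀ g → ε ^ g ≈ ε
  ε-^ g = trans (∙-congʳ (identityʳ _)) (inverseˡ g)

  ^-homo-∙ : ∀ x y g → (x ∙ y) ^ g ≈ x ^ g ∙ y ^ g
  ^-homo-∙ x y g = begin
    g ⁻¹ ∙ (x ∙ y) ∙ g                ≈⟨ solve monoid ⟩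
    (g ⁻¹ ∙ x) ∙ (y ∙ g)              ≈⟨ cancelᶜ (inverseʳ g) (g ⁻¹ ∙ x) (y ∙ g) ⟨
    (g ⁻¹ ∙ x ∙ g) ∙ (g ⁻¹ ∙ (y ∙ g)) ≈⟨ solve monoid ⟩
    (g ⁻¹ ∙ x ∙ g) ∙ (g ⁻¹ ∙ y ∙ g)   ∎

  ^-homo-⁻¹ : ∀ x g → (x ⁻¹) ^ g ≈ (x ^ g) ⁻¹
  ^-homo-⁻¹ x g = inverseʳ-unique (x ^ g) ((x ⁻¹) ^ g)
    (trans (sym (^-homo-∙ x (x ⁻¹) g)) (trans (^-congˡ (inverseʳ x)) (ε-^ g)))

  ^-∙ : ∀ x g h → x ^ (g ∙ h) ≈ (x ^ g) ^ h
  ^-∙ x g h = begin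
    (g ∙ h) ⁻¹ ∙ x ∙ (g ∙ h)      ≈⟨ ∙-congʳ (∙-congʳ (⁻¹-anti-homo-∙ g h)) ⟩
    h ⁻¹ ∙ g ⁻¹ ∙ x ∙ (g ∙ h)     ≈⟨ solve monoid ⟩
    h ⁻¹ ∙ (g ⁻¹ ∙ x ∙ g) ∙ h     ∎

  ^-^⁻¹ : ∀ x g → (x ^ g) ^ (g ⁻¹) ≈ x
  ^-^⁻¹ x g = trans (sym (^-∙ x g (g ⁻¹))) (trans (^-congʳ (inverseʳ g)) (^-identityʳ x))

  ^⁻¹-^ : ∀ x g → (x ^ (g ⁻¹)) ^ g ≈ x
  ^⁻¹-^ x g = trans (^-congʳ (sym (⁻¹-involutive g))) (^-^⁻¹ x (g ⁻¹))

  ^⁻¹-unfold : ∀ x g → x ^ (g ⁻¹) ≈ g ∙ x ∙ g ⁻¹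
  ^⁻¹-unfold x g = ∙-congʳ (∙-congʳ (⁻¹-involutive g))

  Commute : Carrier → Carrier → Set ℓ
  Commute x y = x ∙ y ≈ y ∙ x

  commute⇒^≈ : ∀ {x g} → Commute x g → x ^ g ≈ x
  commute⇒^≈ {x} {g} xg≈gx = begin
    g ⁻¹ ∙ x ∙ g      ≈⟨ assoc (g ⁻¹) x g ⟩
    g ⁻¹ ∙ (x ∙ g)    ≈⟨ ∙-congˡ xg≈gx ⟩
    g ⁻¹ ∙ (g ∙ x)    ≈⟨ \\-leftDividesʳ g x ⟩
    x                 ∎

  commute-⁻¹ʳ : ∀ {x g} → Commute x g → Commute x (g ⁻¹)
  commute-⁻¹ʳ {x} {g} xg≈gx = sym (begin
    g ⁻¹ ∙ x              ≈⟨ insertʳ (inverseʳ g) (g ⁻¹ ∙ x) ⟩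
    g ⁻¹ ∙ x ∙ g ∙ g ⁻¹   ≈⟨ ∙-congʳ (commute⇒^≈ xg≈gx) ⟩
    x ∙ g ⁻¹              ∎)

  commute-∙ʳ : ∀ {x g h} → Commute x g → Commute x h → Commute x (g ∙ h)
  commute-∙ʳ {x} {g} {h} xg≈gx xh≈hx = begin
    x ∙ (g ∙ h)   ≈⟨ sym (assoc x g h) ⟩
    x ∙ g ∙ h     ≈⟨ ∙-congʳ xg≈gx ⟩
    g ∙ x ∙ h     ≈⟨ assoc g x h ⟩
    g ∙ (x ∙ h)   ≈⟨ ∙-congˡ xh≈hx ⟩
    g ∙ (h ∙ x)   ≈⟨ sym (assoc g h x) ⟩
    g ∙ h ∙ x     ∎

  Gen-commute : ∀ {s} {S : Carrier → Set s} {x y} →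
                (∀ {w} → S w → Commute x w) → Gen S y → Commute x y
  Gen-commute commutes (gen s)    = commutes s
  Gen-commute commutes unit       = ε-comm _
  Gen-commute commutes (mul p q)  = commute-∙ʳ (Gen-commute commutes p) (Gen-commute commutes q)
  Gen-commute commutes (inv p)    = commute-⁻¹ʳ (Gen-commute commutes p)
  Gen-commute commutes (resp e p) =
    trans (∙-congˡ (sym e)) (trans (Gen-commute commutes p) (∙-congʳ e))

  ⟨⟩-commute : ∀ {g x y} → ⟨ g ⟩ x → ⟨ g ⟩ y → Commute x y
  ⟨⟩-commute {g} x∈⟨g⟩ = Gen-commute λ w≈g → sym (Gen-commute (copies-commute w≈g) x∈⟨g⟩)
    where
    copies-commute : ∀ {w w'} → w ≈ g → w' ≈ g → Commute w w'
    copies-commute w≈g w'≈g = trans (∙-cong w≈g w'≈g) (∙-cong (sym w'≈g) (sym w≈g))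

  Gen-⊆ : ∀ {s t} {S : Carrier → Set s} {T : Carrier → Set t} {x} →
          (∀ {w} → S w → Gen T w) → Gen S x → Gen T x
  Gen-⊆ S⊆T (gen s)    = S⊆T s
  Gen-⊆ S⊆T unit       = unit
  Gen-⊆ S⊆T (mul p q)  = mul (Gen-⊆ S⊆T p) (Gen-⊆ S⊆T q)
  Gen-⊆ S⊆T (inv p)    = inv (Gen-⊆ S⊆T p)
  Gen-⊆ S⊆T (resp e p) = resp e (Gen-⊆ S⊆T p)

  ⟨⟩-cong : ∀ {g h x} → g ≈ h → ⟨ g ⟩ x → ⟨ h ⟩ x
  ⟨⟩-cong g≈h = Gen-⊆ λ w≈g → gen (trans w≈g g≈h)

  ⟨⟩-cancelˡ : ∀ {g x y} → ⟨ g ⟩ x → ⟨ g ⟩ (x ∙ y) → ⟨ g ⟩ y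
  ⟨⟩-cancelˡ {x = x} {y} x∈ xy∈ = resp (\\-leftDividesʳ x y) (mul (inv x∈) xy∈)

  ⟨⟩∩⟨⟩-resp : ∀ {g h x y} → x ≈ y → (⟨ g ⟩ ∩ ⟨ h ⟩) x → (⟨ g ⟩ ∩ ⟨ h ⟩) y
  ⟨⟩∩⟨⟩-resp x≈y (p , q) = resp x≈y p , resp x≈y q

  ⟨⟩-^ : ∀ {g h x} → ⟨ g ⟩ x → ⟨ g ^ h ⟩ (x ^ h)
  ⟨⟩-^ (gen x≈g)             = gen (^-congˡ x≈g)
  ⟨⟩-^ {h = h} unit          = resp (sym (ε-^ h)) unit
  ⟨⟩-^ {h = h} (mul {x} {y} p q) = resp (sym (^-homo-∙ x y h)) (mul (⟨⟩-^ p) (⟨⟩-^ q))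
  ⟨⟩-^ {h = h} (inv {x} p)   = resp (sym (^-homo-⁻¹ x h)) (inv (⟨⟩-^ p))
  ⟨⟩-^ (resp e p)            = resp (^-congˡ e) (⟨⟩-^ p)

  ⟨⟩-inverted : ∀ {g h x} → g ^ h ≈ g ⁻¹ → ⟨ g ⟩ x → x ^ h ≈ x ⁻¹
  ⟨⟩-inverted g^h≈g⁻¹ (gen x≈g) = trans (^-congˡ x≈g) (trans g^h≈g⁻¹ (⁻¹-cong (sym x≈g)))
  ⟨⟩-inverted {h = h} _ unit = trans (ε-^ h) (sym ε⁻¹≈ε)
  ⟨⟩-inverted {h = h} g^h≈g⁻¹ (mul {x} {y} p q) = begin
    (x ∙ y) ^ h      ≈⟨ ^-homo-∙ x y h ⟩
    x ^ h ∙ y ^ h    ≈⟨ ∙-cong (⟨⟩-inverted g^h≈g⁻¹ p) (⟨⟩-inverted g^h≈g⁻¹ q) ⟩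
    x ⁻¹ ∙ y ⁻¹      ≈⟨ ⁻¹-anti-homo-∙ y x ⟨
    (y ∙ x) ⁻¹       ≈⟨ ⁻¹-cong (⟨⟩-commute q p) ⟩
    (x ∙ y) ⁻¹       ∎
  ⟨⟩-inverted {h = h} g^h≈g⁻¹ (inv {x} p) =
    trans (^-homo-⁻¹ x h) (⁻¹-cong (⟨⟩-inverted g^h≈g⁻¹ p))
  ⟨⟩-inverted g^h≈g⁻¹ (resp e p) =
    trans (^-congˡ (sym e)) (trans (⟨⟩-inverted g^h≈g⁻¹ p) (⁻¹-cong e))

  -- Conjugation by g and by g⁻¹ must both be checked: a subgroup may be
  -- mapped properly into itself by conjugation in an infinite group.
  normal-from-generators : ∀ {s p} {S : Carrier → Set s} {H : Carrier → Set p} →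
    (∀ {x y} → x ≈ y → H x → H y) →
    (∀ {g} → S g → ∀ {x} → H x → H (x ^ g) × H (x ^ (g ⁻¹))) →
    (∀ g → Gen S g) → IsNormal H
  normal-from-generators {S = S} {H} resp-H conj-closed generated g x hx =
    proj₁ (closed (generated g) hx)
    where
    closed : ∀ {g} → Gen S g → ∀ {x} → H x → H (x ^ g) × H (x ^ (g ⁻¹))
    closed (gen s) = conj-closed s
    closed unit {x} hx =
      resp-H (sym (^-identityʳ x)) hx , resp-H (sym (trans (^-congʳ ε⁻¹≈ε) (^-identityʳ x))) hx
    closed (mul {g} {h} p q) {x} hx =
      resp-H (sym (^-∙ x g h)) (proj₁ (closed q (proj₁ (closed p hx)))) ,
      resp-H (sym (trans (^-congʳ (⁻¹-anti-homo-∙ g h)) (^-∙ x (h ⁻¹) (g ⁻¹))))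
             (proj₂ (closed p (proj₂ (closed q hx))))
    closed (inv {g} p) hx =
      proj₂ (closed p hx) , resp-H (^-congʳ (sym (⁻¹-involutive g))) (proj₁ (closed p hx))
    closed (resp e p) hx =
      resp-H (^-congʳ e) (proj₁ (closed p hx)) , resp-H (^-congʳ (⁻¹-cong e)) (proj₂ (closed p hx))

  index≤2-dichotomy : ∀ {p q} {Q : Carrier → Set p} {K : Carrier → Set q} {g k k'} →
    IndexAtMost2 (⟨ g ⟩ ∩ Q) K → K k → K k' → ⟨ g ⟩ k ⊎ ⟨ g ⟩ k' ⊎ ⟨ g ⟩ (k ∙ k' ⁻¹)
  index≤2-dichotomy {k = k} {k'} (t , _ , cosets) k∈K k'∈K with cosets k k∈K | cosets k' k'∈K
  ... | inj₁ (k∈ , _)  | _                = inj₁ k∈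
  ... | inj₂ _         | inj₁ (k'∈ , _)   = inj₂ (inj₁ k'∈)
  ... | inj₂ (kt∈ , _) | inj₂ (k't∈ , _)  = inj₂ (inj₂ (resp same-coset (mul kt∈ (inv k't∈))))
    where
    same-coset : k ∙ t ⁻¹ ∙ (k' ∙ t ⁻¹) ⁻¹ ≈ k ∙ k' ⁻¹
    same-coset = begin
      k ∙ t ⁻¹ ∙ (k' ∙ t ⁻¹) ⁻¹      ≈⟨ ∙-congˡ (⁻¹-anti-homo-∙ k' (t ⁻¹)) ⟩
      k ∙ t ⁻¹ ∙ (t ⁻¹ ⁻¹ ∙ k' ⁻¹)   ≈⟨ cancelᶜ (inverseʳ (t ⁻¹)) k (k' ⁻¹) ⟩
      k ∙ k' ⁻¹                      ∎

  _·_ : ∀ {p q} → (Carrier → Set p) → (Carrier → Set q) → Carrier → Set (c ⊔ ℓ ⊔ p ⊔ q)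
  (H · K) g = Σ Carrier λ x → Σ Carrier λ y → H x × K y × (g ≈ x ∙ y)

  Gen·Gen-⁻¹ : ∀ {s t} {S : Carrier → Set s} {T : Carrier → Set t} {g} →
               (Gen S · Gen T) (g ⁻¹) → (Gen T · Gen S) g
  Gen·Gen-⁻¹ {g = g} (x , y , x∈ , y∈ , g⁻¹≈xy) =
    y ⁻¹ , x ⁻¹ , inv y∈ , inv x∈ ,
    trans (sym (⁻¹-involutive g)) (trans (⁻¹-cong g⁻¹≈xy) (⁻¹-anti-homo-∙ x y))

  normal⇒product : ∀ {a z} → IsNormal ⟨ a ⟩ → ∀ {g} → ⟨ a & z ⟩ g → (⟨ a ⟩ · ⟨ z ⟩) g
  normal⇒product {a} {z} normal = factor
    where
    factor : ∀ {g} → ⟨ a & z ⟩ g → (⟨ a ⟩ · ⟨ z ⟩) g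
    factor (gen (inj₁ g≈a)) = _ , ε , gen g≈a , unit , sym (identityʳ _)
    factor (gen (inj₂ g≈z)) = ε , _ , unit , gen g≈z , sym (identityˡ _)
    factor unit = ε , ε , unit , unit , sym (identityˡ ε)
    factor (mul {g} {g'} p q) with factor p | factor q
    ... | x , y , x∈ , y∈ , g≈xy | x' , y' , x'∈ , y'∈ , g'≈x'y' =
      x ∙ x' ^ (y ⁻¹) , y ∙ y' , mul x∈ (normal (y ⁻¹) x' x'∈) , mul y∈ y'∈ , (begin
        g ∙ g'                              ≈⟨ ∙-cong g≈xy g'≈x'y' ⟩
        x ∙ y ∙ (x' ∙ y')                   ≈⟨ ∙-congˡ (∙-congˡ (\\-leftDividesʳ y y')) ⟨
        x ∙ y ∙ (x' ∙ (y ⁻¹ ∙ (y ∙ y')))    ≈⟨ solve monoid ⟩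
        x ∙ (y ∙ x' ∙ y ⁻¹) ∙ (y ∙ y')      ≈⟨ ∙-congʳ (∙-congˡ (^⁻¹-unfold x' y)) ⟨
        x ∙ x' ^ (y ⁻¹) ∙ (y ∙ y')          ∎)
    factor (inv {g} p) with factor p
    ... | x , y , x∈ , y∈ , g≈xy =
      (x ⁻¹) ^ y , y ⁻¹ , normal y (x ⁻¹) (inv x∈) , inv y∈ , (begin
        g ⁻¹                       ≈⟨ ⁻¹-cong g≈xy ⟩
        (x ∙ y) ⁻¹                 ≈⟨ ⁻¹-anti-homo-∙ x y ⟩
        y ⁻¹ ∙ x ⁻¹                ≈⟨ //-rightDividesʳ y (y ⁻¹ ∙ x ⁻¹) ⟨
        y ⁻¹ ∙ x ⁻¹ ∙ y ∙ y ⁻¹     ∎)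
    factor (resp g≈g' p) with factor p
    ... | x , y , x∈ , y∈ , g≈xy = x , y , x∈ , y∈ , trans (sym g≈g') g≈xy

  pow-+ : ∀ x m n → pow x (m + n) ≈ pow x m ∙ pow x n
  pow-+ x zero    n = sym (identityˡ _)
  pow-+ x (suc m) n = trans (∙-congˡ (pow-+ x m n)) (sym (assoc _ _ _))

  pow∈⟨⟩ : ∀ x m → ⟨ x ⟩ (pow x m)
  pow∈⟨⟩ x zero    = unit
  pow∈⟨⟩ x (suc m) = mul (gen refl) (pow∈⟨⟩ x m)

  module FiniteOrder {a : Carrier} {n : ℕ} (order : IsOrder a n) where
    private instance
      n≢0 : NonZero n
      n≢0 = >-nonZero (proj₁ order)

    pow-multiple : ∀ q → pow a (q * n) ≈ ε
    pow-multiple zero    = refl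
    pow-multiple (suc q) =
      trans (pow-+ a n (q * n)) (trans (∙-cong (proj₁ (proj₂ order)) (pow-multiple q)) (identityˡ ε))

    pow-% : ∀ m → pow a m ≈ pow a (m % n)
    pow-% m = begin
      pow a m                                 ≡⟨ ≡.cong (pow a) (m≡m%n+[m/n]*n m n) ⟩
      pow a (m % n + (m / n) * n)             ≈⟨ pow-+ a (m % n) ((m / n) * n) ⟩
      pow a (m % n) ∙ pow a ((m / n) * n)     ≈⟨ ∙-congˡ (pow-multiple (m / n)) ⟩
      pow a (m % n) ∙ ε                       ≈⟨ identityʳ _ ⟩
      pow a (m % n)                           ∎

    pow-⁻¹ : ∀ m → pow a m ⁻¹ ≈ pow a ((n ∸ 1) * m)
    pow-⁻¹ m = sym (inverseʳ-unique (pow a m) _ (begin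
      pow a m ∙ pow a ((n ∸ 1) * m)    ≈⟨ pow-+ a m ((n ∸ 1) * m) ⟨
      pow a (m + (n ∸ 1) * m)          ≡⟨ ≡.cong (pow a) m+[n∸1]m≡mn ⟩
      pow a (m * n)                    ≈⟨ pow-multiple m ⟩
      ε                                ∎))
      where
      m+[n∸1]m≡mn : m + (n ∸ 1) * m ≡ m * n
      m+[n∸1]m≡mn = ≡.trans (≡.cong (_* m) (m+[n∸m]≡n (proj₁ order))) (*-comm n m)

    ⟨⟩⇒pow : ∀ {x} → ⟨ a ⟩ x → ∃ λ m → x ≈ pow a m
    ⟨⟩⇒pow (gen x≈a) = 1 , trans x≈a (sym (identityʳ a))
    ⟨⟩⇒pow unit      = 0 , refl
    ⟨⟩⇒pow (mul p q) with ⟨⟩⇒pow p | ⟨⟩⇒pow q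
    ... | m , x≈aᵐ | m' , y≈aᵐ' = m + m' , trans (∙-cong x≈aᵐ y≈aᵐ') (sym (pow-+ a m m'))
    ⟨⟩⇒pow (inv p) with ⟨⟩⇒pow p
    ... | m , x≈aᵐ = (n ∸ 1) * m , trans (⁻¹-cong x≈aᵐ) (pow-⁻¹ m)
    ⟨⟩⇒pow (resp x≈y p) with ⟨⟩⇒pow p
    ... | m , x≈aᵐ = m , trans (sym x≈y) x≈aᵐ

    ⟨⟩⇒pow<n : ∀ {x} → ⟨ a ⟩ x → Σ (Fin n) λ i → x ≈ pow a (toℕ i)
    ⟨⟩⇒pow<n x∈ with ⟨⟩⇒pow x∈
    ... | m , x≈aᵐ = fromℕ< (m%n<n m n) ,
      trans x≈aᵐ (trans (pow-% m) (reflexive (≡.cong (pow a) (≡.sym (toℕ-fromℕ< (m%n<n m n))))))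

    pow-distinct : ∀ {i j} → i < j → j < n → ¬ pow a i ≈ pow a j
    pow-distinct {i} {j} i<j j<n aⁱ≈aʲ =
      proj₂ (proj₂ order) (j ∸ i) (m<n⇒0<n∸m i<j) (≤-<-trans (m∸n≤m j i) j<n) aʲ⁻ⁱ≈ε
      where
      aʲ⁻ⁱ≈ε : pow a (j ∸ i) ≈ ε
      aʲ⁻ⁱ≈ε = identityʳ-unique (pow a i) (pow a (j ∸ i)) (begin
        pow a i ∙ pow a (j ∸ i)   ≈⟨ pow-+ a i (j ∸ i) ⟨
        pow a (i + (j ∸ i))       ≡⟨ ≡.cong (pow a) (m+[n∸m]≡n (<⇒≤ i<j)) ⟩
        pow a j                   ≈⟨ aⁱ≈aʲ ⟨
        pow a i                   ∎)

    pow-injective : ∀ {i j} → i < n → j < n → pow a i ≈ pow a j → i ≡ j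
    pow-injective {i} {j} i<n j<n aⁱ≈aʲ with <-cmp i j
    ... | tri< i<j _ _ = ⊥-elim (pow-distinct i<j j<n aⁱ≈aʲ)
    ... | tri≈ _ i≡j _ = i≡j
    ... | tri> _ _ j<i = ⊥-elim (pow-distinct j<i i<n (sym aⁱ≈aʲ))

  order-2-elements : ∀ {t x} → IsOrder t 2 → ⟨ t ⟩ x → x ≈ ε ⊎ x ≈ t
  order-2-elements order x∈ with FiniteOrder.⟨⟩⇒pow<n order x∈
  ... | Fin.zero , x≈ε = inj₁ x≈ε
  ... | Fin.suc Fin.zero , x≈t∙ε = inj₂ (trans x≈t∙ε (identityʳ _))

module RotaryPairProperties {c ℓ : Level} (G : Group c ℓ) {a z : Group.Carrier G} {n : ℕ}
                            (rotary : GroupDefs.RotaryPair G a z n) where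
  open Group G
  open GroupDefs G
  open CosetGraph a z
  open GroupProperties G
  open RotaryPair rotary
  open import Algebra.Properties.Group G
  open import Relation.Binary.Reasoning.Setoid setoid

  z²≈ε : z ∙ z ≈ ε
  z²≈ε = trans (∙-congˡ (sym (identityʳ z))) (proj₁ (proj₂ order-z))

  z⁻¹≈z : z ⁻¹ ≈ z
  z⁻¹≈z = sym (inverseʳ-unique z z z²≈ε)

  normal-if-^z-closed : ∀ {p} {H : Carrier → Set p} →
    (∀ {x y} → x ≈ y → H x → H y) → (∀ {x} → H x → ⟨ a ⟩ x) → (∀ {x} → H x → H (x ^ z)) →
    IsNormal H
  normal-if-^z-closed {H = H} resp-H H⊆⟨a⟩ ^z-closed =
    normal-from-generators resp-H closed generates
    where
    closed : ∀ {g} → g ≈ a ⊎ g ≈ z → ∀ {x} → H x → H (x ^ g) × H (x ^ (g ⁻¹))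
    closed (inj₁ g≈a) hx =
      resp-H (sym (commute⇒^≈ xg≈gx)) hx , resp-H (sym (commute⇒^≈ (commute-⁻¹ʳ xg≈gx))) hx
      where xg≈gx = ⟨⟩-commute (H⊆⟨a⟩ hx) (gen g≈a)
    closed (inj₂ g≈z) hx = resp-H (^-congʳ (sym g≈z)) (^z-closed hx) ,
                           resp-H (^-congʳ (sym (trans (⁻¹-cong g≈z) z⁻¹≈z))) (^z-closed hx)

  ⟨a⟩∩⟨a^z⟩-normal : IsNormal (⟨ a ⟩ ∩ ⟨ a ^ z ⟩)
  ⟨a⟩∩⟨a^z⟩-normal = normal-if-^z-closed ⟨⟩∩⟨⟩-resp proj₁ λ (x∈⟨a⟩ , x∈⟨a^z⟩) →
    ⟨⟩-cong (trans (^-congʳ (sym z⁻¹≈z)) (^-^⁻¹ a z)) (⟨⟩-^ x∈⟨a^z⟩) , ⟨⟩-^ x∈⟨a⟩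

  kernel≈⟨a⟩∩⟨a^z⟩ : ∀ g → (InKernel g → (⟨ a ⟩ ∩ ⟨ a ^ z ⟩) g)
                          × ((⟨ a ⟩ ∩ ⟨ a ^ z ⟩) g → InKernel g)
  kernel≈⟨a⟩∩⟨a^z⟩ g = fixes-all⇒∈ , ∈⇒fixes-all
    where
    fixes-all⇒∈ : InKernel g → (⟨ a ⟩ ∩ ⟨ a ^ z ⟩) g
    fixes-all⇒∈ fixes =
      resp (trans (∙-cong (identityˡ g) ε⁻¹≈ε) (identityʳ g)) (fixes ε) ,
      resp (trans (^-congˡ (sym (^⁻¹-unfold g z))) (^⁻¹-^ g z)) (⟨⟩-^ (fixes z))
    ∈⇒fixes-all : (⟨ a ⟩ ∩ ⟨ a ^ z ⟩) g → InKernel g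
    ∈⇒fixes-all g∈ x = resp (^⁻¹-unfold g x) (proj₁ (⟨a⟩∩⟨a^z⟩-normal (x ⁻¹) g g∈))

  ⟨a⟩∩⟨az⟩-normal : IsNormal (⟨ a ⟩ ∩ ⟨ a ∙ z ⟩)
  ⟨a⟩∩⟨az⟩-normal = normal-if-^z-closed ⟨⟩∩⟨⟩-resp proj₁ λ x∈ →
    ⟨⟩∩⟨⟩-resp (sym (commute⇒^≈ (commutes-z x∈))) x∈
    where
    z∈⟨a,az⟩ : ⟨ a & a ∙ z ⟩ z
    z∈⟨a,az⟩ = resp (\\-leftDividesʳ a z) (mul (inv (gen (inj₁ refl))) (gen (inj₂ refl)))
    commutes-z : ∀ {x} → (⟨ a ⟩ ∩ ⟨ a ∙ z ⟩) x → Commute x z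
    commutes-z (x∈⟨a⟩ , x∈⟨az⟩) =
      Gen-commute [ (λ w≈a → ⟨⟩-commute x∈⟨a⟩ (gen w≈a)) , (λ w≈az → ⟨⟩-commute x∈⟨az⟩ (gen w≈az)) ]
                  z∈⟨a,az⟩

  ⟨a⟩∩⟨zz^a⟩-normal : IsNormal (⟨ a ⟩ ∩ ⟨ z ∙ (z ^ a) ⟩)
  ⟨a⟩∩⟨zz^a⟩-normal = normal-if-^z-closed ⟨⟩∩⟨⟩-resp proj₁ λ (x∈⟨a⟩ , x∈⟨w⟩) →
    ⟨⟩∩⟨⟩-resp (sym (⟨⟩-inverted w^z≈w⁻¹ x∈⟨w⟩)) (inv x∈⟨a⟩ , inv x∈⟨w⟩)
    where
    z^a≈[z^a]⁻¹ : z ^ a ≈ (z ^ a) ⁻¹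
    z^a≈[z^a]⁻¹ = trans (^-congˡ (sym z⁻¹≈z)) (^-homo-⁻¹ z a)
    w^z≈w⁻¹ : (z ∙ (z ^ a)) ^ z ≈ (z ∙ (z ^ a)) ⁻¹
    w^z≈w⁻¹ = begin
      z ⁻¹ ∙ (z ∙ (z ^ a)) ∙ z     ≈⟨ ∙-congʳ (\\-leftDividesʳ z (z ^ a)) ⟩
      z ^ a ∙ z                    ≈⟨ ∙-cong z^a≈[z^a]⁻¹ (sym z⁻¹≈z) ⟩
      (z ^ a) ⁻¹ ∙ z ⁻¹            ≈⟨ ⁻¹-anti-homo-∙ z (z ^ a) ⟨
      (z ∙ (z ^ a)) ⁻¹             ∎

  az∉⟨a⟩ : ¬ ⟨ a ⟩ (a ∙ z)
  az∉⟨a⟩ az∈ = z∉⟨a⟩ (⟨⟩-cancelˡ (gen refl) az∈)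

  a^z∈⟨a⟩-if-index≤2 : IndexAtMost2 (⟨ a ⟩ ∩ ⟨ a ∙ z ⟩) ⟨ a ∙ z ⟩
                     ⊎ IndexAtMost2 (⟨ a ⟩ ∩ ⟨ z & z ^ a ⟩) ⟨ z & z ^ a ⟩ → ⟨ a ⟩ (a ^ z)
  a^z∈⟨a⟩-if-index≤2 (inj₁ index≤2)
    with index≤2-dichotomy index≤2 (mul (gen refl) (gen refl)) (gen refl)
  ... | inj₁ azaz∈ = ⟨⟩-cancelˡ (gen refl) (resp azaz≈a∙a^z azaz∈)
    where
    azaz≈a∙a^z : a ∙ z ∙ (a ∙ z) ≈ a ∙ (a ^ z)
    azaz≈a∙a^z = begin
      a ∙ z ∙ (a ∙ z)        ≈⟨ solve monoid ⟩
      a ∙ (z ∙ a ∙ z)        ≈⟨ ∙-congˡ (∙-congʳ (∙-congʳ (sym z⁻¹≈z))) ⟩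
      a ∙ (z ⁻¹ ∙ a ∙ z)     ∎
  ... | inj₂ (inj₁ az∈) = ⊥-elim (az∉⟨a⟩ az∈)
  ... | inj₂ (inj₂ az∈) = ⊥-elim (az∉⟨a⟩ (resp (//-rightDividesʳ (a ∙ z) (a ∙ z)) az∈))
  a^z∈⟨a⟩-if-index≤2 (inj₂ index≤2)
    with index≤2-dichotomy index≤2 (gen (inj₁ refl)) (gen (inj₂ refl))
  ... | inj₁ z∈ = ⊥-elim (z∉⟨a⟩ z∈)
  ... | inj₂ (inj₁ z^a∈) = ⊥-elim (z∉⟨a⟩ (resp z^a≈z z^a∈))
    where
    z^a≈z : z ^ a ≈ z
    z^a≈z = trans (sym (commute⇒^≈ (commute-⁻¹ʳ (⟨⟩-commute z^a∈ (gen refl))))) (^-^⁻¹ z a)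
  ... | inj₂ (inj₂ zz^a∈) =
    resp (⁻¹-involutive (a ^ z)) (inv (resp shift (mul zz^a∈ (inv (gen refl)))))
    where
    shift : z ∙ (z ^ a) ⁻¹ ∙ a ⁻¹ ≈ (a ^ z) ⁻¹
    shift = begin
      z ∙ (z ^ a) ⁻¹ ∙ a ⁻¹              ≈⟨ ∙-congʳ (∙-congˡ (^-homo-⁻¹ z a)) ⟨
      z ∙ (a ⁻¹ ∙ z ⁻¹ ∙ a) ∙ a ⁻¹       ≈⟨ solve monoid ⟩
      z ∙ a ⁻¹ ∙ z ⁻¹ ∙ a ∙ a ⁻¹         ≈⟨ //-rightDividesʳ a (z ∙ a ⁻¹ ∙ z ⁻¹) ⟩
      z ∙ a ⁻¹ ∙ z ⁻¹                    ≈⟨ ∙-cong (∙-congʳ (sym z⁻¹≈z)) z⁻¹≈z ⟩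
      z ⁻¹ ∙ a ⁻¹ ∙ z                    ≈⟨ ^-homo-⁻¹ a z ⟩
      (a ^ z) ⁻¹                         ∎

  module ⟨a⟩Normal (a^z∈⟨a⟩ : ⟨ a ⟩ (a ^ z)) where
    open FiniteOrder order-a

    ⟨a⟩-normal : IsNormal ⟨ a ⟩
    ⟨a⟩-normal = normal-if-^z-closed resp (λ x∈ → x∈) λ x∈ →
      Gen-⊆ (λ w≈a^z → resp (sym w≈a^z) a^z∈⟨a⟩) (⟨⟩-^ x∈)

    ⟨a⟩∩⟨z⟩-trivial : ∀ g → ⟨ a ⟩ g → ⟨ z ⟩ g → g ≈ ε
    ⟨a⟩∩⟨z⟩-trivial g g∈⟨a⟩ g∈⟨z⟩ with order-2-elements order-z g∈⟨z⟩
    ... | inj₁ g≈ε = g≈ε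
    ... | inj₂ g≈z = ⊥-elim (z∉⟨a⟩ (resp g≈z g∈⟨a⟩))

    ⟨a⟩⟨z⟩-factorisation : ∀ g → (⟨ a ⟩ · ⟨ z ⟩) g
    ⟨a⟩⟨z⟩-factorisation g = normal⇒product ⟨a⟩-normal (generates g)

    ⟨z⟩⟨a⟩-factorisation : ∀ g → (⟨ z ⟩ · ⟨ a ⟩) g
    ⟨z⟩⟨a⟩-factorisation g = Gen·Gen-⁻¹ (⟨a⟩⟨z⟩-factorisation (g ⁻¹))

    vertex-ε-or-z : ∀ g → VertexEq g ε ⊎ VertexEq g z
    vertex-ε-or-z g with ⟨a⟩⟨z⟩-factorisation g
    ... | x , y , x∈ , y∈ , g≈xy = Sum.map move move (order-2-elements order-z y∈)
      where
      g//y∈⟨a⟩ : ⟨ a ⟩ (g // y)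
      g//y∈⟨a⟩ = resp (sym (trans (∙-congʳ g≈xy) (//-rightDividesʳ y x))) x∈
      move : ∀ {u} → y ≈ u → VertexEq g u
      move y≈u = resp (∙-congˡ (⁻¹-cong y≈u)) g//y∈⟨a⟩

    ε≁z : ¬ VertexEq ε z
    ε≁z ε//z∈ = z∉⟨a⟩ (resp (trans (identityˡ _) z⁻¹≈z) ε//z∈)

    z≁ε : ¬ VertexEq z ε
    z≁ε z//ε∈ = z∉⟨a⟩ (resp (trans (∙-congˡ ε⁻¹≈ε) (identityʳ z)) z//ε∈)

    vertices : CardIs 2 VertexEq (λ _ → ⊤ {c ⊔ ℓ})
    vertices = rep , (λ _ → tt) , rep-injective , λ g _ →
      [ (λ g∼ε → Fin.zero , g∼ε) , (λ g∼z → Fin.suc Fin.zero , g∼z) ]′ (vertex-ε-or-z g)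
      where
      rep : Fin 2 → Carrier
      rep Fin.zero           = ε
      rep (Fin.suc Fin.zero) = z
      rep-injective : ∀ i j → VertexEq (rep i) (rep j) → i ≡ j
      rep-injective Fin.zero           Fin.zero           _ = ≡.refl
      rep-injective Fin.zero           (Fin.suc Fin.zero) p = ⊥-elim (ε≁z p)
      rep-injective (Fin.suc Fin.zero) Fin.zero           p = ⊥-elim (z≁ε p)
      rep-injective (Fin.suc Fin.zero) (Fin.suc Fin.zero) _ = ≡.refl

    incident : ∀ g h → Incident g h
    incident g h with ⟨z⟩⟨a⟩-factorisation (h // g)
    ... | y , x , y∈ , x∈ , h//g≈yx =
      y ⁻¹ ∙ h ,
      resp (sym (trans (assoc _ _ _) (trans (∙-congˡ h//g≈yx) (\\-leftDividesʳ y x)))) x∈ ,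
      resp (sym (//-rightDividesʳ h (y ⁻¹))) (inv y∈)

    edge-rep : ∀ h → Σ (Fin n) λ i → EdgeEq h (pow a (toℕ i))
    edge-rep h with ⟨z⟩⟨a⟩-factorisation h
    ... | y , x , y∈ , x∈ , h≈yx with ⟨⟩⇒pow<n x∈
    ... | i , x≈aⁱ =
      i , resp (sym (trans (∙-cong h≈yx (⁻¹-cong (sym x≈aⁱ))) (//-rightDividesʳ x y))) y∈

    edge-rep-injective : ∀ i j → EdgeEq (pow a (toℕ i)) (pow a (toℕ j)) → i ≡ j
    edge-rep-injective i j p = toℕ-injective (pow-injective (toℕ<n i) (toℕ<n j)
      (x∙y⁻¹≈ε⇒x≈y _ _ (⟨a⟩∩⟨z⟩-trivial _ (mul (pow∈⟨⟩ a (toℕ i)) (inv (pow∈⟨⟩ a (toℕ j)))) p)))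

    edges : ∀ {p} {P : Carrier → Set p} → (∀ h → P h) → CardIs n EdgeEq P
    edges all = (λ i → pow a (toℕ i)) , (λ i → all _) , edge-rep-injective , λ h _ → edge-rep h

    K₂ : IsK2 n
    K₂ = vertices , edges _ , λ u v _ → edges λ h → incident u h , incident v h

lemma3p5 : ∀ {c ℓ : Level} (G : Group c ℓ) (a z : Group.Carrier G) (n : ℕ) →
    let open Group G
        open GroupDefs G
        open CosetGraph a z
    in RotaryPair a z n →
       -- (a) kernel of the action on V is ⟨a⟩ ∩ ⟨a^z⟩
       (∀ g → (InKernel g → (⟨ a ⟩ ∩ ⟨ a ^ z ⟩) g) × ((⟨ a ⟩ ∩ ⟨ a ^ z ⟩) g → InKernel g))
       -- (b) normality
       × IsNormal (⟨ a ⟩ ∩ ⟨ a ∙ z ⟩)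
       × IsNormal (⟨ a ⟩ ∩ ⟨ z ∙ (z ^ a) ⟩)
       -- (c)
       × ((IndexAtMost2 (⟨ a ⟩ ∩ ⟨ a ∙ z ⟩) ⟨ a ∙ z ⟩
           ⊎ IndexAtMost2 (⟨ a ⟩ ∩ ⟨ z & z ^ a ⟩) ⟨ z & z ^ a ⟩) →
          -- G = ⟨a⟩ ⋊ ⟨z⟩
          (IsNormal ⟨ a ⟩
           × (∀ g → ⟨ a ⟩ g → ⟨ z ⟩ g → g ≈ ε)
           × (∀ g → Σ Carrier λ x → Σ Carrier λ y → ⟨ a ⟩ x × ⟨ z ⟩ y × (g ≈ x ∙ y)))
          -- Γ = K₂^(λ) with λ = |a| = n
          × IsK2 n)
lemma3p5 G a z n rotary =
  kernel≈⟨a⟩∩⟨a^z⟩ , ⟨a⟩∩⟨az⟩-normal , ⟨a⟩∩⟨zz^a⟩-normal ,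
  λ index≤2 → let open ⟨a⟩Normal (a^z∈⟨a⟩-if-index≤2 index≤2) in
    (⟨a⟩-normal , ⟨a⟩∩⟨z⟩-trivial , ⟨a⟩⟨z⟩-factorisation) , K₂
  where open RotaryPairProperties G rotary
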